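{- Let $m \geq 3$ be an integer and let $S := \langle m, 2m-1, 3m-2, \ldots, (m-1)^2\rangle$ be the numerical semigroup generated by the integers $km-(k-1)$ for $k = 1, \ldots, m-1$ (equivalently, $S = \{i(m-1)+jm : i,j \in \mathbb{N},\ j \neq 0\} \cup \{0\}$). Put $s := \left\lceil \frac{m-1}{2}\right\rceil (m-1) + 1$. Then $\sigma$ attains its maximum over $S \cap [0,c(S)]$ at $s$, and $$\sigma(s) = \frac{1}{2}\left\lceil \frac{m-1}{2}\right\rceil\left(\left\lfloor \frac{m-1}{2}\right\rfloor + 1\right) - \frac{1}{2}.$$
   Context: A numerical semigroup is a subset $S \subseteq \mathbb{N} = \{0,1,2,\ldots\}$ closed under addition, containing $0$, with finite complement. Its Frobenius number is $F(S) := \max(\mathbb{N}\setminus S)$ and its conductor is $c(S) := F(S)+1$. For $s \in S \cap [0,c(S)]$ define $\sigma(s) := \frac{s}{2} - |S \cap [0,s]| + 1$. -}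

module Defs where

open import Data.Nat using (ℕ; zero; suc; _+_; _*_; _∸_; _≤_; _≤?_; _≟_)
open import Data.Integer as ℤ using (ℤ)
open import Data.Fin using (Fin; toℕ)
open import Data.Fin.Properties using (any?)
open import Data.Product using (Σ; _×_; _,_)
open import Data.Sum using (_⊎_)
open import Data.List using (List; length; filter; upTo)
open import Relation.Nullary using (Dec; ¬_)
open import Relation.Nullary.Decidable using (_⊎-dec_; _×-dec_)
open import Relation.Binary.PropositionalEquality using (_≡_)

-- The witnesses i, j are taken in Fin (suc n), i.e. i, j ≤ n; for m ≥ 3
-- this is no restriction since i(m-1) + jm = n forces i, j ≤ n.
InS : ℕ → ℕ → Set
InS m n = n ≡ 0 ⊎
  Σ (Fin (suc n)) λ i → Σ (Fin (suc n)) λ j →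
    (1 ≤ toℕ j) × (n ≡ toℕ i * (m ∸ 1) + toℕ j * m)

InS? : ∀ m n → Dec (InS m n)
InS? m n = (n ≟ 0) ⊎-dec any? (λ i → any? (λ j →
             (1 ≤? toℕ j) ×-dec (n ≟ toℕ i * (m ∸ 1) + toℕ j * m)))

countS : ℕ → ℕ → ℕ
countS m s = length (filter (InS? m) (upTo (suc s)))

-- 2·σ(s) = s - 2 |S ∩ [0,s]| + 2   (an integer; σ itself may be a half-integer)
twiceσ : ℕ → ℕ → ℤ
twiceσ m s = ℤ.+ s ℤ.- ℤ.+ (2 * countS m s) ℤ.+ ℤ.+ 2

IsFrobenius : ℕ → ℕ → Set
IsFrobenius m F = (¬ InS m F) × (∀ n → suc F ≤ n → InS m n)

{-# OPTIONS --safe #-}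
-- Write m = n + 1. The nonzero elements of S are the numbers K n + j with
-- 1 ≤ j ≤ K, so for K ≤ n the stretch (K n, (K + 1) n] of ℕ meets S exactly
-- in K n + 1, …, K n + K, and F = n².  Counting block by block gives
-- 2 |S ∩ [0, K n]| = 2 + K² − K, hence 2σ(K n + j) = K (n + 1 − K) − j for
-- j ≤ K ≤ n.  This is largest for j = 1 and for the most balanced split
-- K + (n + 1 − K) = n + 1, that is K = ⌈n/2⌉.
module Submission where

open import Defs
open import Data.Nat using (ℕ; zero; suc; _+_; _*_; _∸_; _≤_; _<_; pred; ⌈_/2⌉; ⌊_/2⌋; z≤n; s≤s;
                            NonZero; >-nonZero; >-nonZero⁻¹; _%_; _/_)
open import Data.Nat.Properties
open import Data.Nat.DivMod using (m≡m%n+[m/n]*n; m%n<n)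
open import Data.Nat.Tactic.RingSolver using (solve)
open import Data.Integer as ℤ using (_⊖_)
import Data.Integer.Properties as ℤₚ
open import Data.Product using (_×_; _,_; ∃₂)
open import Data.Sum using (_⊎_; inj₁; inj₂)
open import Data.Fin using (toℕ; fromℕ<)
open import Data.Fin.Properties using (toℕ-fromℕ<)
open import Data.List using (_∷_; []; [_]; _++_; length; filter; upTo)
open import Data.List.Properties using (length-++; filter-++; filter-accept; filter-reject; upTo-∷ʳ)
open import Function using (_∘_)
open import Relation.Nullary using (¬_)
open import Relation.Binary.PropositionalEquality
  using (_≡_; refl; sym; trans; cong; cong₂; subst; subst₂; module ≡-Reasoning)

m+q≡n+p⇒m⊖p≡n⊖q : ∀ m n p q → m + q ≡ n + p → m ⊖ p ≡ n ⊖ q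
m+q≡n+p⇒m⊖p≡n⊖q m n p q eq = begin
  m ⊖ p             ≡⟨ ℤₚ.+-cancelˡ-⊖ q m p ⟨
  (q + m) ⊖ (q + p) ≡⟨ cong₂ _⊖_ (trans (+-comm q m) (trans eq (+-comm n p))) (+-comm q p) ⟩
  (p + n) ⊖ (p + q) ≡⟨ ℤₚ.+-cancelˡ-⊖ p n q ⟩
  n ⊖ q             ∎
  where open ≡-Reasoning

m+q≤n+p⇒m⊖p≤n⊖q : ∀ m n p q → m + q ≤ n + p → m ⊖ p ℤ.≤ n ⊖ q
m+q≤n+p⇒m⊖p≤n⊖q m n p q le = begin
  m ⊖ p             ≡⟨ ℤₚ.+-cancelˡ-⊖ q m p ⟨
  (q + m) ⊖ (q + p) ≤⟨ ℤₚ.⊖-monoˡ-≤ (q + p) (subst₂ _≤_ (+-comm m q) (+-comm n p) le) ⟩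
  (p + n) ⊖ (q + p) ≡⟨ cong ((p + n) ⊖_) (+-comm q p) ⟩
  (p + n) ⊖ (p + q) ≡⟨ ℤₚ.+-cancelˡ-⊖ p n q ⟩
  n ⊖ q             ∎
  where open ℤₚ.≤-Reasoning

-- With a = x + p and b = x + q one has a * b = x * y + p * q.
*-≤-*-of-spread : ∀ {x y a b} → x + y ≡ a + b → x ≤ a → a ≤ b → x * y ≤ a * b
*-≤-*-of-spread {x} {y} sum x≤a a≤b
  with m≤n⇒∃[o]m+o≡n x≤a | m≤n⇒∃[o]m+o≡n (≤-trans x≤a a≤b)
... | p , refl | q , refl = begin
  x * y                     ≡⟨ cong (x *_) y≡ ⟩
  x * (p + (x + q))         ≤⟨ m≤m+n _ (p * q) ⟩
  x * (p + (x + q)) + p * q ≡⟨ solve (x ∷ p ∷ q ∷ []) ⟩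
  (x + p) * (x + q)         ∎
  where
  open ≤-Reasoning
  y≡ : y ≡ p + (x + q)
  y≡ = +-cancelˡ-≡ x y _ (trans sum (+-assoc x p (x + q)))

*-≤-*-of-balanced : ∀ {x y a b} → x + y ≡ a + b → a ≤ b → b ≤ suc a → x * y ≤ a * b
*-≤-*-of-balanced {x} {y} {a} {b} sum a≤b b≤1+a with ≤-<-connex x a
... | inj₁ x≤a = *-≤-*-of-spread sum x≤a a≤b
... | inj₂ a<x = subst (_≤ a * b) (*-comm y x) (*-≤-*-of-spread (trans (+-comm y x) sum) y≤a a≤b)
  where
  y≤a : y ≤ a
  y≤a = +-cancelʳ-≤ b y a (≤-trans (+-monoʳ-≤ y (≤-trans b≤1+a a<x))
                                    (≤-reflexive (trans (+-comm y x) sum)))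

m+n≡o⇒m*[1+n]≤⌈o/2⌉*[1+⌊o/2⌋] : ∀ {m n o} → m + n ≡ o → m * suc n ≤ ⌈ o /2⌉ * suc ⌊ o /2⌋
m+n≡o⇒m*[1+n]≤⌈o/2⌉*[1+⌊o/2⌋] {m} {n} {o} m+n≡o =
  *-≤-*-of-balanced {m} {suc n} sum (⌊n/2⌋-mono (n≤1+n (suc o))) (s≤s (⌊n/2⌋≤⌈n/2⌉ o))
  where
  open ≡-Reasoning
  sum : m + suc n ≡ ⌈ o /2⌉ + suc ⌊ o /2⌋
  sum = begin
    m + suc n                ≡⟨ +-suc m n ⟩
    suc (m + n)              ≡⟨ cong suc (trans m+n≡o (sym (⌊n/2⌋+⌈n/2⌉≡n o))) ⟩
    suc (⌊ o /2⌋ + ⌈ o /2⌉)  ≡⟨ cong suc (+-comm ⌊ o /2⌋ ⌈ o /2⌉) ⟩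
    suc (⌈ o /2⌉ + ⌊ o /2⌋)  ≡⟨ +-suc ⌈ o /2⌉ ⌊ o /2⌋ ⟨
    ⌈ o /2⌉ + suc ⌊ o /2⌋    ∎

IsFrobenius-unique : ∀ {m F G} → IsFrobenius m F → IsFrobenius m G → F ≡ G
IsFrobenius-unique (F∉S , >F⇒∈S) (G∉S , >G⇒∈S) =
  ≤-antisym (≮⇒≥ (λ G<F → F∉S (>G⇒∈S _ G<F))) (≮⇒≥ (λ F<G → G∉S (>F⇒∈S _ F<G)))

countS-suc : ∀ m t → countS m (suc t) ≡ countS m t + length (filter (InS? m) [ suc t ])
countS-suc m t = begin
  length (filter (InS? m) (upTo (suc (suc t))))
    ≡⟨ cong (length ∘ filter (InS? m)) (upTo-∷ʳ (suc t)) ⟨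
  length (filter (InS? m) (upTo (suc t) ++ [ suc t ]))
    ≡⟨ cong length (filter-++ (InS? m) (upTo (suc t)) [ suc t ]) ⟩
  length (filter (InS? m) (upTo (suc t)) ++ filter (InS? m) [ suc t ])
    ≡⟨ length-++ (filter (InS? m) (upTo (suc t))) ⟩
  countS m t + length (filter (InS? m) [ suc t ]) ∎
  where open ≡-Reasoning

countS-suc-∈ : ∀ {m t} → InS m (suc t) → countS m (suc t) ≡ suc (countS m t)
countS-suc-∈ {m} {t} ∈S = begin
  countS m (suc t)                                ≡⟨ countS-suc m t ⟩
  countS m t + length (filter (InS? m) [ suc t ])
    ≡⟨ cong (λ xs → countS m t + length xs) (filter-accept (InS? m) ∈S) ⟩
  countS m t + 1                                  ≡⟨ +-comm (countS m t) 1 ⟩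
  suc (countS m t)                                ∎
  where open ≡-Reasoning

countS-suc-∉ : ∀ {m t} → ¬ InS m (suc t) → countS m (suc t) ≡ countS m t
countS-suc-∉ {m} {t} ∉S = begin
  countS m (suc t)                                ≡⟨ countS-suc m t ⟩
  countS m t + length (filter (InS? m) [ suc t ])
    ≡⟨ cong (λ xs → countS m t + length xs) (filter-reject (InS? m) ∉S) ⟩
  countS m t + 0                                  ≡⟨ +-identityʳ (countS m t) ⟩
  countS m t                                      ∎
  where open ≡-Reasoning

countS-+-∈ : ∀ {m} a r → (∀ {i} → i < r → InS m (a + suc i)) → countS m (a + r) ≡ countS m a + r
countS-+-∈ {m} a zero _ = trans (cong (countS m) (+-identityʳ a)) (sym (+-identityʳ (countS m a)))
countS-+-∈ {m} a (suc r) ∈S = begin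
  countS m (a + suc r)    ≡⟨ cong (countS m) (+-suc a r) ⟩
  countS m (suc (a + r))  ≡⟨ countS-suc-∈ (subst (InS m) (+-suc a r) (∈S (n<1+n r))) ⟩
  suc (countS m (a + r))  ≡⟨ cong suc (countS-+-∈ a r (∈S ∘ m<n⇒m<1+n)) ⟩
  suc (countS m a + r)    ≡⟨ +-suc (countS m a) r ⟨
  countS m a + suc r      ∎
  where open ≡-Reasoning

countS-+-∉ : ∀ {m} a r → (∀ {i} → i < r → ¬ InS m (a + suc i)) → countS m (a + r) ≡ countS m a
countS-+-∉ {m} a zero _ = cong (countS m) (+-identityʳ a)
countS-+-∉ {m} a (suc r) ∉S = begin
  countS m (a + suc r)    ≡⟨ cong (countS m) (+-suc a r) ⟩
  countS m (suc (a + r))  ≡⟨ countS-suc-∉ (∉S (n<1+n r) ∘ subst (InS m) (sym (+-suc a r))) ⟩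
  countS m (a + r)        ≡⟨ countS-+-∉ a r (∉S ∘ m<n⇒m<1+n) ⟩
  countS m a              ∎
  where open ≡-Reasoning

i*n+j*[1+n]≡[i+j]*n+j : ∀ i j n → i * n + j * suc n ≡ (i + j) * n + j
i*n+j*[1+n]≡[i+j]*n+j i j n = solve (i ∷ j ∷ n ∷ [])

InS-intro : ∀ {n} .{{_ : NonZero n}} i j → 1 ≤ j → InS (suc n) (i * n + j * suc n)
InS-intro {n} i j 1≤j =
  inj₂ (fromℕ< i< , fromℕ< j< , subst (1 ≤_) (sym (toℕ-fromℕ< j<)) 1≤j ,
        cong₂ (λ a b → a * n + b * suc n) (sym (toℕ-fromℕ< i<)) (sym (toℕ-fromℕ< j<)))
  where
  i< : i < suc (i * n + j * suc n)
  i< = s≤s (≤-trans (m≤m*n i n) (m≤m+n (i * n) (j * suc n)))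
  j< : j < suc (i * n + j * suc n)
  j< = s≤s (≤-trans (m≤m*n j (suc n)) (m≤n+m (j * suc n) (i * n)))

InS⇒0⊎block : ∀ {n t} → InS (suc n) t → t ≡ 0 ⊎ ∃₂ λ K j → 1 ≤ j × j ≤ K × t ≡ K * n + j
InS⇒0⊎block (inj₁ t≡0) = inj₁ t≡0
InS⇒0⊎block {n} (inj₂ (i , j , 1≤j , t≡)) =
  inj₂ (toℕ i + toℕ j , toℕ j , 1≤j , m≤n+m (toℕ j) (toℕ i) ,
        trans t≡ (i*n+j*[1+n]≡[i+j]*n+j (toℕ i) (toℕ j) n))

block-∈ : ∀ {n} .{{_ : NonZero n}} {k r} → 1 ≤ r → r ≤ k → InS (suc n) (k * n + r)
block-∈ {n} {k} {r} 1≤r r≤k with m≤n⇒∃[o]m+o≡n r≤k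
... | d , refl = subst (InS (suc n)) regroup (InS-intro d r 1≤r)
  where
  regroup : d * n + r * suc n ≡ (r + d) * n + r
  regroup = trans (i*n+j*[1+n]≡[i+j]*n+j d r n) (cong (λ k → k * n + r) (+-comm d r))

-- Nonzero elements lie in intervals (K n, K n + K]; k n + r falls strictly between two of them.
block-∉ : ∀ {n k r} → k < r → r ≤ n → ¬ InS (suc n) (k * n + r)
block-∉ {n} {k} {r} k<r r≤n ∈S with InS⇒0⊎block ∈S
... | inj₁ ≡0 = <-irrefl (sym (m+n≡0⇒n≡0 (k * n) ≡0)) (≤-<-trans z≤n k<r)
... | inj₂ (K , j , 1≤j , j≤K , eq) with ≤-<-connex K k
...   | inj₁ K≤k = <-irrefl (sym eq) (begin-strict
  K * n + j ≤⟨ +-monoʳ-≤ (K * n) j≤K ⟩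
  K * n + K ≤⟨ +-mono-≤ (*-monoˡ-≤ n K≤k) K≤k ⟩
  k * n + k <⟨ +-monoʳ-< (k * n) k<r ⟩
  k * n + r ∎)
  where open ≤-Reasoning
...   | inj₂ k<K = <-irrefl eq (begin-strict
  k * n + r ≤⟨ +-monoʳ-≤ (k * n) r≤n ⟩
  k * n + n ≡⟨ +-comm (k * n) n ⟩
  suc k * n ≤⟨ *-monoˡ-≤ n k<K ⟩
  K * n     <⟨ m<m+n (K * n) 1≤j ⟩
  K * n + j ∎)
  where open ≤-Reasoning

IsFrobenius-square : ∀ {n} .{{_ : NonZero n}} → IsFrobenius (suc n) (n * n)
IsFrobenius-square {n} = square∉S , >square⇒∈S
  where
  square∉S : ¬ InS (suc n) (n * n)
  square∉S = block-∉ (≤-reflexive (suc-pred n)) ≤-refl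
           ∘ subst (InS (suc n)) (trans (cong (_* n) (sym (suc-pred n))) (+-comm n (pred n * n)))
  split : ∀ q r → (n + q) * n + suc r ≡ suc (n * n) + (r + q * n)
  split q r = solve (n ∷ q ∷ r ∷ [])
  >square⇒∈S : ∀ t → suc (n * n) ≤ t → InS (suc n) t
  >square⇒∈S t square<t with m≤n⇒∃[o]m+o≡n square<t
  ... | u , refl = subst (InS (suc n))
    (trans (split (u / n) (u % n)) (cong (suc (n * n) +_) (sym (m≡m%n+[m/n]*n u n))))
    (block-∈ (s≤s z≤n) (≤-trans (m%n<n u n) (m≤m+n n (u / n))))

countS-block-head : ∀ {n} .{{_ : NonZero n}} {K j} → j ≤ K →
                    countS (suc n) (K * n + j) ≡ countS (suc n) (K * n) + j
countS-block-head {n} {K} {j} j≤K = countS-+-∈ (K * n) j (λ i<j → block-∈ (s≤s z≤n) (≤-trans i<j j≤K))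

countS-block : ∀ {n} .{{_ : NonZero n}} {K d} → K + d ≡ n →
               countS (suc n) (suc K * n) ≡ countS (suc n) (K * n) + K
countS-block {n} {K} {d} K+d≡n = begin
  countS (suc n) (suc K * n)      ≡⟨ cong (countS (suc n)) layout ⟩
  countS (suc n) (K * n + K + d)  ≡⟨ countS-+-∉ (K * n + K) d gap ⟩
  countS (suc n) (K * n + K)      ≡⟨ countS-block-head {K = K} ≤-refl ⟩
  countS (suc n) (K * n) + K      ∎
  where
  open ≡-Reasoning
  layout : suc K * n ≡ K * n + K + d
  layout = trans (+-comm n (K * n)) (trans (cong (K * n +_) (sym K+d≡n)) (sym (+-assoc (K * n) K d)))
  gap : ∀ {i} → i < d → ¬ InS (suc n) (K * n + K + suc i)
  gap {i} i<d = block-∉ (m<m+n K (s≤s z≤n)) (≤-trans (+-monoʳ-≤ K i<d) (≤-reflexive K+d≡n))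
          ∘ subst (InS (suc n)) (+-assoc (K * n) K (suc i))

countS-blocks : ∀ {n} .{{_ : NonZero n}} {K} → K ≤ n → 2 * countS (suc n) (K * n) + K ≡ 2 + K * K
countS-blocks {K = zero} _ = refl
countS-blocks {n} {suc K} K<n with m≤n⇒∃[o]m+o≡n K<n
... | d , 1+K+d≡n = next (countS-block {K = K} (trans (+-suc K d) 1+K+d≡n)) (countS-blocks (<⇒≤ K<n))
  where
  open ≡-Reasoning
  next : ∀ {c c′} → c′ ≡ c + K → 2 * c + K ≡ 2 + K * K → 2 * c′ + suc K ≡ 2 + suc K * suc K
  next {c} refl ih = begin
    2 * (c + K) + suc K        ≡⟨ solve (c ∷ K ∷ []) ⟩
    (2 * c + K) + (2 * K + 1)  ≡⟨ cong (_+ (2 * K + 1)) ih ⟩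
    2 + K * K + (2 * K + 1)    ≡⟨ solve (K ∷ []) ⟩
    2 + suc K * suc K          ∎

twiceσ≡⊖ : ∀ m t → twiceσ m t ≡ (t + 2) ⊖ (2 * countS m t)
twiceσ≡⊖ m t = trans (cong (ℤ._+ ℤ.+ 2) (ℤₚ.[+m]-[+n]≡m⊖n t (2 * countS m t)))
                     (ℤₚ.distribˡ-⊖-+-pos 2 t (2 * countS m t))

twiceσ-block : ∀ {n} .{{_ : NonZero n}} {K d j} → K + d ≡ n → j ≤ K →
               twiceσ (suc n) (K * n + j) ≡ K * suc d ⊖ j
twiceσ-block {K = K} {d} {j} refl j≤K = begin
  twiceσ (suc n) t            ≡⟨ twiceσ≡⊖ (suc n) t ⟩
  (t + 2) ⊖ (2 * countS (suc n) t)
    ≡⟨ m+q≡n+p⇒m⊖p≡n⊖q (t + 2) (K * suc d) (2 * countS (suc n) t) j (+-cancelʳ-≡ K _ _ balance) ⟩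
  K * suc d ⊖ j               ∎
  where
  open ≡-Reasoning
  n = K + d
  t = K * n + j
  c = countS (suc n) (K * n)
  regroup : ∀ x → K * suc d + (2 * x + K) + 2 * j ≡ K * suc d + 2 * (x + j) + K
  regroup x = solve (K ∷ d ∷ j ∷ x ∷ [])
  balance : t + 2 + j + K ≡ K * suc d + 2 * countS (suc n) t + K
  balance = begin
    K * (K + d) + j + 2 + j + K      ≡⟨ solve (K ∷ d ∷ j ∷ []) ⟩
    K * suc d + (2 + K * K) + 2 * j  ≡⟨ cong (λ x → K * suc d + x + 2 * j) (countS-blocks (m≤m+n K d)) ⟨
    K * suc d + (2 * c + K) + 2 * j  ≡⟨ regroup c ⟩
    K * suc d + 2 * (c + j) + K      ≡⟨ cong (λ x → K * suc d + 2 * x + K) (countS-block-head {K = K} j≤K) ⟨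
    K * suc d + 2 * countS (suc n) t + K ∎

twiceσ≤⌈n/2⌉*[1+⌊n/2⌋]⊖1 : ∀ {n} .{{_ : NonZero n}} {t} → InS (suc n) t → t ≤ suc (n * n) →
                           twiceσ (suc n) t ℤ.≤ ⌈ n /2⌉ * suc ⌊ n /2⌋ ⊖ 1
twiceσ≤⌈n/2⌉*[1+⌊n/2⌋]⊖1 {n} t∈S t≤ with InS⇒0⊎block t∈S
... | inj₁ refl = begin
  twiceσ (suc n) 0             ≡⟨ twiceσ-block {K = 0} refl z≤n ⟩
  0 ⊖ 0                        ≤⟨ m+q≤n+p⇒m⊖p≤n⊖q 0 H 0 1 (≤-trans 1≤H (m≤m+n H 0)) ⟩
  H ⊖ 1                        ∎
  where
  open ℤₚ.≤-Reasoning
  H = ⌈ n /2⌉ * suc ⌊ n /2⌋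
  1≤H : 1 ≤ H
  1≤H = *-mono-≤ (⌈n/2⌉-mono (>-nonZero⁻¹ n)) (s≤s z≤n)
... | inj₂ (K , j , 1≤j , j≤K , refl) = begin
  twiceσ (suc n) (K * n + j)   ≡⟨ twiceσ-block (m+[n∸m]≡n K≤n) j≤K ⟩
  K * suc (n ∸ K) ⊖ j
    ≤⟨ m+q≤n+p⇒m⊖p≤n⊖q (K * suc (n ∸ K)) H j 1
         (+-mono-≤ (m+n≡o⇒m*[1+n]≤⌈o/2⌉*[1+⌊o/2⌋] {K} {n ∸ K} (m+[n∸m]≡n K≤n)) 1≤j) ⟩
  H ⊖ 1                        ∎
  where
  open ℤₚ.≤-Reasoning
  H = ⌈ n /2⌉ * suc ⌊ n /2⌋
  K≤n : K ≤ n
  K≤n = *-cancelʳ-≤ K n n (+-cancelʳ-≤ 1 (K * n) (n * n)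
          (≤-trans (+-monoʳ-≤ (K * n) 1≤j) (≤-trans t≤ (≤-reflexive (+-comm 1 (n * n))))))

corollary3p5 : ∀ (m : ℕ) → 3 ≤ m → ∀ (F : ℕ) → IsFrobenius m F →
    InS m (⌈ m ∸ 1 /2⌉ * (m ∸ 1) + 1)
    × (⌈ m ∸ 1 /2⌉ * (m ∸ 1) + 1) ≤ suc F
    × (∀ (t : ℕ) → InS m t → t ≤ suc F →
        twiceσ m t ℤ.≤ twiceσ m (⌈ m ∸ 1 /2⌉ * (m ∸ 1) + 1))
    × twiceσ m (⌈ m ∸ 1 /2⌉ * (m ∸ 1) + 1)
        ≡ ℤ.+ (⌈ m ∸ 1 /2⌉ * (⌊ m ∸ 1 /2⌋ + 1)) ℤ.- ℤ.+ 1
corollary3p5 (suc n) (s≤s 2≤n) F isF = s∈S , s≤1+F , σ≤σ[s] , σ[s]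
  where
  instance
    n≢0 : NonZero n
    n≢0 = >-nonZero (≤-trans (s≤s z≤n) 2≤n)
  h = ⌈ n /2⌉
  f = ⌊ n /2⌋
  F≡n*n : F ≡ n * n
  F≡n*n = IsFrobenius-unique isF IsFrobenius-square
  1≤h : 1 ≤ h
  1≤h = ⌈n/2⌉-mono (>-nonZero⁻¹ n)
  s∈S : InS (suc n) (h * n + 1)
  s∈S = block-∈ ≤-refl 1≤h
  s≤1+F : h * n + 1 ≤ suc F
  s≤1+F = subst (λ F → h * n + 1 ≤ suc F) (sym F≡n*n)
            (≤-trans (+-monoˡ-≤ 1 (*-monoˡ-≤ n (⌈n/2⌉≤n n))) (≤-reflexive (+-comm (n * n) 1)))
  σ[s]≡ : twiceσ (suc n) (h * n + 1) ≡ h * suc f ⊖ 1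
  σ[s]≡ = twiceσ-block (trans (+-comm h f) (⌊n/2⌋+⌈n/2⌉≡n n)) 1≤h
  σ≤σ[s] : ∀ t → InS (suc n) t → t ≤ suc F → twiceσ (suc n) t ℤ.≤ twiceσ (suc n) (h * n + 1)
  σ≤σ[s] t t∈S t≤1+F = subst (twiceσ (suc n) t ℤ.≤_) (sym σ[s]≡)
                         (twiceσ≤⌈n/2⌉*[1+⌊n/2⌋]⊖1 t∈S (subst (λ F → t ≤ suc F) F≡n*n t≤1+F))
  σ[s] : twiceσ (suc n) (h * n + 1) ≡ ℤ.+ (h * (f + 1)) ℤ.- ℤ.+ 1
  σ[s] = trans σ[s]≡ (trans (cong (λ x → h * x ⊖ 1) (+-comm 1 f)) (sym (ℤₚ.[+m]-[+n]≡m⊖n (h * (f + 1)) 1)))
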